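{- Let $B$ be a broom with $b$ hairs and $S$ a star with $s$ rays. Let $T(B,S)$ be the rooted tree of depth two in which the root has $2\max\{b+1, s\} - 1$ children and each child of the root has exactly $s$ children. Then every red/blue colouring of the edges of $T(B,S)$ contains either a monochromatic copy of $B$, or both a red copy of $S$ and a blue copy of $S$.
   Context: A broom with $b$ hairs is the tree obtained from a path of length two by attaching $b$ new leaves (hairs) to one of its endpoints. A star with $s$ rays is $K_{1,s}$. -}

module Defs where

open import Data.Nat using (ℕ; suc; _*_; _∸_; _⊔_)
open import Data.Fin using (Fin)
open import Data.Product using (Σ; _×_)
open import Function.Definitions using (Injective)
open import Relation.Binary.PropositionalEquality using (_≡_)

data Colour : Set where
  red blue : Colour

-- A (simple, undirected) graph given by a vertex type and an adjacency
-- relation (all graphs below have symmetric, irreflexive adjacency).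
record Graph : Set₁ where
  field
    V : Set
    E : V → V → Set
open Graph public

Copy : Graph → Graph → Set
Copy H G = Σ (V H → V G) λ f →
  Injective _≡_ _≡_ f × (∀ u v → E H u v → E G (f u) (f v))

data BroomV (b : ℕ) : Set where
  tip mid hub : BroomV b
  hair        : Fin b → BroomV b

data BroomE (b : ℕ) : BroomV b → BroomV b → Set where
  tip-mid  : BroomE b tip mid
  mid-tip  : BroomE b mid tip
  mid-hub  : BroomE b mid hub
  hub-mid  : BroomE b hub mid
  hub-hair : (k : Fin b) → BroomE b hub (hair k)
  hair-hub : (k : Fin b) → BroomE b (hair k) hub

Broom : ℕ → Graph
Broom b = record { V = BroomV b ; E = BroomE b }

data StarV (s : ℕ) : Set where
  centre : StarV s
  ray    : Fin s → StarV s

data StarE (s : ℕ) : StarV s → StarV s → Set where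
  centre-ray : (j : Fin s) → StarE s centre (ray j)
  ray-centre : (j : Fin s) → StarE s (ray j) centre

Star : ℕ → Graph
Star s = record { V = StarV s ; E = StarE s }

data TreeV (m s : ℕ) : Set where
  root  : TreeV m s
  child : Fin m → TreeV m s
  leaf  : Fin m → Fin s → TreeV m s

-- A red/blue colouring of the edges of this tree: the edge root—child i
-- gets colour  rootCol i , the edge child i—leaf i j gets  leafCol i j .
record TreeColouring (m s : ℕ) : Set where
  constructor colouring
  field
    rootCol : Fin m → Colour
    leafCol : Fin m → Fin s → Colour
open TreeColouring public

data TreeE {m s : ℕ} (χ : TreeColouring m s) (c : Colour)
     : TreeV m s → TreeV m s → Set where
  root-child : (i : Fin m) → rootCol χ i ≡ c → TreeE χ c root (child i)
  child-root : (i : Fin m) → rootCol χ i ≡ c → TreeE χ c (child i) root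
  child-leaf : (i : Fin m) (j : Fin s) → leafCol χ i j ≡ c →
               TreeE χ c (child i) (leaf i j)
  leaf-child : (i : Fin m) (j : Fin s) → leafCol χ i j ≡ c →
               TreeE χ c (leaf i j) (child i)

ColourClass : {m s : ℕ} → TreeColouring m s → Colour → Graph
ColourClass {m} {s} χ c = record { V = TreeV m s ; E = TreeE χ c }

rootDegree : ℕ → ℕ → ℕ
rootDegree b s = 2 * (suc b ⊔ s) ∸ 1

-- Some colour c occurs on M = max{b+1, s} of the 2M − 1 root edges.  Pick one
-- such child i.  If an edge from i down to a leaf also has colour c, then
-- leaf — i — root together with b further c-coloured root edges is a broom of
-- colour c.  Otherwise all s leaf edges below i have the other colour, a star
-- of that colour centred at i, while the root with s of its c-coloured edges
-- is a star of colour c.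
module Submission where

open import Defs
open import Data.Nat using (ℕ; zero; suc; _+_; _*_; _⊔_; _≤_; _≤?_)
open import Data.Nat.Properties
  using (≤-trans; +-suc; +-identityʳ; +-monoˡ-≤; +-cancelˡ-≤; ≰⇒>; m≤n+m∸n; m≤m⊔n; m≤n⊔m)
open import Data.Fin using (Fin; inject≤) renaming (zero to fzero; suc to fsuc)
open import Data.Fin.Properties using (any?; suc-injective; inject≤-injective)
open import Data.Product using (Σ; _×_; _,_)
open import Data.Sum using (_⊎_; inj₁; inj₂)
open import Data.Empty using (⊥-elim)
open import Function.Definitions using (Injective)
open import Relation.Nullary using (¬_; Dec; yes; no)
open import Relation.Binary.PropositionalEquality using (_≡_; refl; cong; trans; subst)

_≟_ : (x y : Colour) → Dec (x ≡ y)
red  ≟ red  = yes refl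
red  ≟ blue = no λ ()
blue ≟ red  = no λ ()
blue ≟ blue = yes refl

other : Colour → Colour
other red  = blue
other blue = red

≢⇒≡other : ∀ {x c} → ¬ x ≡ c → x ≡ other c
≢⇒≡other {red}  {red}  x≢c = ⊥-elim (x≢c refl)
≢⇒≡other {red}  {blue} _   = refl
≢⇒≡other {blue} {red}  _   = refl
≢⇒≡other {blue} {blue} x≢c = ⊥-elim (x≢c refl)

record Occurrences {A : Set} {n : ℕ} (f : Fin n → A) (a : A) (r : ℕ) : Set where
  field
    index           : Fin r → Fin n
    index-injective : Injective _≡_ _≡_ index
    index-value     : ∀ k → f (index k) ≡ a
open Occurrences

module _ {A : Set} {n : ℕ} {f : Fin (suc n) → A} {a : A} {r : ℕ} where

  Occurrences-there : Occurrences (λ i → f (fsuc i)) a r → Occurrences f a r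
  Occurrences-there o = record
    { index           = λ k → fsuc (index o k)
    ; index-injective = λ e → index-injective o (suc-injective e)
    ; index-value     = index-value o
    }

  Occurrences-here : f fzero ≡ a → Occurrences (λ i → f (fsuc i)) a r →
                     Occurrences f a (suc r)
  Occurrences-here f0≡a o = record
    { index = idx ; index-injective = idx-injective ; index-value = idx-value }
    where
    idx : Fin (suc r) → Fin (suc n)
    idx fzero    = fzero
    idx (fsuc k) = fsuc (index o k)
    idx-injective : Injective _≡_ _≡_ idx
    idx-injective {fzero}  {fzero}  _ = refl
    idx-injective {fsuc k} {fsuc l} e = cong fsuc (index-injective o (suc-injective e))
    idx-injective {fzero}  {fsuc _} ()
    idx-injective {fsuc _} {fzero}  ()
    idx-value : ∀ k → f (idx k) ≡ a
    idx-value fzero    = f0≡a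
    idx-value (fsuc k) = index-value o k

Occurrences-≤ : ∀ {A : Set} {n} {f : Fin n → A} {a r r′} →
                r′ ≤ r → Occurrences f a r → Occurrences f a r′
Occurrences-≤ r′≤r o = record
  { index           = λ k → index o (inject≤ k r′≤r)
  ; index-injective = λ e → inject≤-injective r′≤r r′≤r _ _ (index-injective o e)
  ; index-value     = λ k → index-value o (inject≤ k r′≤r)
  }

partition : ∀ n (f : Fin n → Colour) →
  Σ ℕ λ r → Σ ℕ λ k → r + k ≡ n × Occurrences f red r × Occurrences f blue k
partition zero f = 0 , 0 , refl , none , none
  where
  none : ∀ {a} → Occurrences f a 0
  none = record { index = λ () ; index-injective = λ { {()} } ; index-value = λ () }
partition (suc n) f with partition n (λ i → f (fsuc i)) | f fzero in f0
... | r , k , r+k≡n , reds , blues | red =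
  suc r , k , cong suc r+k≡n , Occurrences-here f0 reds , Occurrences-there blues
... | r , k , r+k≡n , reds , blues | blue =
  r , suc k , trans (+-suc r k) (cong suc r+k≡n) , Occurrences-there reds , Occurrences-here f0 blues

-- If r < M then M + M ≤ 1 + r + k ≤ M + k.
pigeonhole : ∀ M r k → M + M ≤ suc (r + k) → M ≤ r ⊎ M ≤ k
pigeonhole M r k M+M≤ with M ≤? r
... | yes M≤r = inj₁ M≤r
... | no  M≰r = inj₂ (+-cancelˡ-≤ M M k (≤-trans M+M≤ (+-monoˡ-≤ k (≰⇒> M≰r))))

majorityColour : ∀ {n} (f : Fin n → Colour) M → M + M ≤ suc n →
                 Σ Colour λ c → Occurrences f c M
majorityColour {n} f M M+M≤ with partition n f
... | r , k , refl , reds , blues with pigeonhole M r k M+M≤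
...   | inj₁ M≤r = red  , Occurrences-≤ M≤r reds
...   | inj₂ M≤k = blue , Occurrences-≤ M≤k blues

rootDegree-majority : ∀ b s → let M = suc b ⊔ s in M + M ≤ suc (rootDegree b s)
rootDegree-majority b s =
  subst (_≤ suc (rootDegree b s)) (cong (M +_) (+-identityʳ M)) (m≤n+m∸n (2 * M) 1)
  where M = suc b ⊔ s

module _ {m s : ℕ} (χ : TreeColouring m s) (c : Colour) where

  private
    child-injective : ∀ {x y : Fin m} → child {s = s} x ≡ child y → x ≡ y
    child-injective refl = refl

    leaf-injective : ∀ {i : Fin m} {j j′ : Fin s} → leaf i j ≡ leaf i j′ → j ≡ j′
    leaf-injective refl = refl

  rootStar : Occurrences (rootCol χ) c s → Copy (Star s) (ColourClass χ c)
  rootStar o = f , f-injective , f-edge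
    where
    f : StarV s → TreeV m s
    f centre  = root
    f (ray j) = child (index o j)
    f-injective : Injective _≡_ _≡_ f
    f-injective {centre} {centre} _ = refl
    f-injective {ray j}  {ray j′} e = cong ray (index-injective o (child-injective e))
    f-injective {centre} {ray _}  ()
    f-injective {ray _}  {centre} ()
    f-edge : ∀ u v → StarE s u v → TreeE χ c (f u) (f v)
    f-edge _ _ (centre-ray j) = root-child (index o j) (index-value o j)
    f-edge _ _ (ray-centre j) = child-root (index o j) (index-value o j)

  childStar : (i : Fin m) → (∀ j → leafCol χ i j ≡ c) → Copy (Star s) (ColourClass χ c)
  childStar i i-leaves = f , f-injective , f-edge
    where
    f : StarV s → TreeV m s
    f centre  = child i
    f (ray j) = leaf i j
    f-injective : Injective _≡_ _≡_ f
    f-injective {centre} {centre} _ = refl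
    f-injective {ray j}  {ray j′} e = cong ray (leaf-injective e)
    f-injective {centre} {ray _}  ()
    f-injective {ray _}  {centre} ()
    f-edge : ∀ u v → StarE s u v → TreeE χ c (f u) (f v)
    f-edge _ _ (centre-ray j) = child-leaf i j (i-leaves j)
    f-edge _ _ (ray-centre j) = leaf-child i j (i-leaves j)

  rootBroom : ∀ {b} (o : Occurrences (rootCol χ) c (suc b)) (j : Fin s) →
              leafCol χ (index o fzero) j ≡ c → Copy (Broom b) (ColourClass χ c)
  rootBroom {b} o j handle = f , f-injective , f-edge
    where
    i : Fin (suc b) → Fin m
    i = index o
    distinct : ∀ {k l} → child {s = s} (i k) ≡ child (i l) → k ≡ l
    distinct e = index-injective o (child-injective e)
    f : BroomV b → TreeV m s
    f tip      = leaf (i fzero) j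
    f mid      = child (i fzero)
    f hub      = root
    f (hair k) = child (i (fsuc k))
    f-injective : Injective _≡_ _≡_ f
    f-injective {tip}    {tip}    _ = refl
    f-injective {mid}    {mid}    _ = refl
    f-injective {hub}    {hub}    _ = refl
    f-injective {hair k} {hair l} e = cong hair (suc-injective (distinct e))
    f-injective {mid}    {hair _} e with () ← distinct e
    f-injective {hair _} {mid}    e with () ← distinct e
    f-injective {tip}    {mid}    ()
    f-injective {tip}    {hub}    ()
    f-injective {tip}    {hair _} ()
    f-injective {mid}    {tip}    ()
    f-injective {mid}    {hub}    ()
    f-injective {hub}    {tip}    ()
    f-injective {hub}    {mid}    ()
    f-injective {hub}    {hair _} ()
    f-injective {hair _} {tip}    ()
    f-injective {hair _} {hub}    ()
    f-edge : ∀ u v → BroomE b u v → TreeE χ c (f u) (f v)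
    f-edge _ _ tip-mid      = leaf-child (i fzero) j handle
    f-edge _ _ mid-tip      = child-leaf (i fzero) j handle
    f-edge _ _ mid-hub      = child-root (i fzero) (index-value o fzero)
    f-edge _ _ hub-mid      = root-child (i fzero) (index-value o fzero)
    f-edge _ _ (hub-hair k) = root-child (i (fsuc k)) (index-value o (fsuc k))
    f-edge _ _ (hair-hub k) = child-root (i (fsuc k)) (index-value o (fsuc k))

broomOrStars : ∀ {m s} b (χ : TreeColouring m s) c →
  Occurrences (rootCol χ) c (suc b) → Occurrences (rootCol χ) c s →
  Copy (Broom b) (ColourClass χ c)
  ⊎ (Copy (Star s) (ColourClass χ c) × Copy (Star s) (ColourClass χ (other c)))
broomOrStars b χ c hairs rays with any? (λ j → leafCol χ (index hairs fzero) j ≟ c)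
... | yes (j , handle) = inj₁ (rootBroom χ c hairs j handle)
... | no  no-handle    = inj₂ ( rootStar χ c rays
                              , childStar χ (other c) (index hairs fzero)
                                  (λ j → ≢⇒≡other λ e → no-handle (j , e)) )

red×blue-from-other : (P : Colour → Set) (c : Colour) → P c × P (other c) → P red × P blue
red×blue-from-other P red  (p , q) = p , q
red×blue-from-other P blue (p , q) = q , p

mainTheorem20 : (b s : ℕ) (χ : TreeColouring (rootDegree b s) s) →
    (Σ Colour λ c → Copy (Broom b) (ColourClass χ c))
    ⊎ (Copy (Star s) (ColourClass χ red) × Copy (Star s) (ColourClass χ blue))
mainTheorem20 b s χ
  with c , majority ← majorityColour (rootCol χ) (suc b ⊔ s) (rootDegree-majority b s)
  with broomOrStars b χ c (Occurrences-≤ (m≤m⊔n (suc b) s) majority)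
                          (Occurrences-≤ (m≤n⊔m (suc b) s) majority)
... | inj₁ broom = inj₁ (c , broom)
... | inj₂ stars = inj₂ (red×blue-from-other (λ c → Copy (Star s) (ColourClass χ c)) c stars)
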